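{- Let $\{x_{n,m}\}_{n\in\mathbb{N}^*,\,1\le m\le n}\subset\mathbb{C}$ satisfy $x_{n+1,k+1}=\sum_{j=k}^{n}x_{n,j}$ for all $n\in\mathbb{N}^*$ and $k\in\{1,\ldots,n\}$. Then for every $n\ge 3$ and every $1\le m\le n-2$, $$x_{n,2}=\sum_{h=1}^m C(m-1,m-h)\sum_{2\le k_{m+1-h}\le k_{m+2-h}\le\cdots\le k_m\le n-m} x_{n-m,k_m}+\sum_{k=0}^{m-1}C_k\,x_{n-k-1,1},$$ where the inner sum runs over all nondecreasing integer tuples $(k_{m+1-h},\ldots,k_m)$ with values in $\{2,\ldots,n-m\}$. In particular, $$x_{n,2}=\sum_{k=0}^{n-2}C_k\,x_{n-k-1,1}\qquad\text{for every } n\ge 3.$$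
   Context: The Catalan's triangle is $C(0,0)=1$ and $C(n,k)=\frac{n+1-k}{n+1}\binom{n+k}{k}$ for $n\in\mathbb{N}^*$, $0\le k\le n$; $C_k=\frac{1}{k+1}\binom{2k}{k}$ denotes the $k$-th Catalan number. -}

module Defs where

open import Level using (Level)
open import Data.Nat using (ℕ; zero; suc; _+_; _*_; _∸_; _≤ᵇ_)
open import Data.Nat.Combinatorics using (_C_)
open import Data.Nat.DivMod using (_/_)
open import Data.Bool using (Bool; true; false; _∧_)
open import Data.List using (List; []; _∷_; map; concatMap; foldr; filter; upTo)
open import Data.Bool.Properties using (T?)
open import Algebra.Bundles using (CommutativeRing)

-- Catalan's triangle: C(n,k) = (n+1-k)/(n+1) * binom(n+k,k)  (exact division);
-- this gives C(0,0) = 1 as well.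
catTri : ℕ → ℕ → ℕ
catTri n k = ((suc n ∸ k) * ((n + k) C k)) / suc n

catalan : ℕ → ℕ
catalan k = ((2 * k) C k) / suc k

-- the integers lo, lo+1, ..., hi  (empty if hi < lo)
range : ℕ → ℕ → List ℕ
range lo hi = map (lo +_) (upTo (suc hi ∸ lo))

tuples : ℕ → List ℕ → List (List ℕ)
tuples zero    vs = [] ∷ []
tuples (suc h) vs = concatMap (λ v → map (v ∷_) (tuples h vs)) vs

nondecreasing : List ℕ → Bool
nondecreasing []            = true
nondecreasing (a ∷ [])      = true
nondecreasing (a ∷ b ∷ r)   = (a ≤ᵇ b) ∧ nondecreasing (b ∷ r)

-- last entry (default 0 for the empty list; only used for nonempty tuples)
lastEntry : List ℕ → ℕ
lastEntry []          = 0
lastEntry (a ∷ [])    = a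
lastEntry (a ∷ b ∷ r) = lastEntry (b ∷ r)

ndTuples : ℕ → ℕ → ℕ → List (List ℕ)
ndTuples h lo hi = filter (λ t → T? (nondecreasing t)) (tuples h (range lo hi))

module _ {c ℓ : Level} (R : CommutativeRing c ℓ) where
  open CommutativeRing R using (Carrier; 0#) renaming (_+_ to _+R_)

  sumR : List Carrier → Carrier
  sumR = foldr _+R_ 0#

  Σ[_⋯_] : ℕ → ℕ → (ℕ → Carrier) → Carrier
  Σ[_⋯_] lo hi f = sumR (map f (range lo hi))

  _·_ : ℕ → Carrier → Carrier
  zero  · a = 0#
  suc k · a = a +R (k · a)

  ndSum : ℕ → ℕ → ℕ → (ℕ → Carrier) → Carrier
  ndSum h lo hi f = sumR (map (λ t → f (lastEntry t)) (ndTuples h lo hi))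

{-# OPTIONS --safe #-}
module Submission where

-- Write σ_N(h, v) for nestedSum (x N) N h v = Σ_{v ≤ k₁ ≤ ⋯ ≤ k_h ≤ N} x_{N,k_h}; ndSum is σ at v = 2.
-- The hypothesis says x_{M+1,u+1} = σ_M(1, u), hence σ_{M+1}(h, u+1) = σ_M(h+1, u), and splitting
-- off the summands with k₁ = 1 gives σ_{N+1}(h, 2) = x_{N,1} + Σ_{j ≤ h} σ_N(j+1, 2).
-- Starting from x_{n,2} = x_{n-1,1} + σ_{n-1}(1, 2) and lowering N one step at a time, x_{N,1}
-- picks up the sum of the current coefficients and the new coefficients are their suffix sums.
-- This is the recurrence C(n+1, k+1) = C(n+1, k) + C(n, k+1) of Catalan's triangle, whose row sums
-- are Catalan numbers; the closed form for C(n, k) follows from the reflection formula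
-- C(n, k) = binom(n+k, k) − binom(n+k, n+1). At N = 1 the nested sums range over {2, …, 1} and
-- vanish, which leaves the Catalan convolution.

open import Defs
open import Level using (Level)
open import Data.Nat as ℕ using (ℕ; zero; suc; _∸_; _≤_; _<_; _≤ᵇ_; z≤n; s≤s)
open import Data.Nat.Properties as ℕ using ()
open import Data.Product using (_,_)
open import Data.Fin using (toℕ; inject₁; fromℕ)
open import Data.Fin.Properties using (toℕ<n; toℕ-inject₁; toℕ-fromℕ)
open import Data.Bool using (Bool; true; false; _∧_; if_then_else_)
open import Data.Bool.Properties using (T?)
open import Data.List using (List; []; _∷_; _++_; map; concatMap; filter; applyUpTo; upTo)
open import Data.List.Properties using (map-∘; map-++; map-cong)
open import Algebra.Bundles using (CommutativeMonoid; CommutativeRing)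
open import Relation.Binary.PropositionalEquality as ≡ using (_≡_; cong; cong₂)
open import Relation.Nullary.Decidable using (dec-true; dec-false)

module IndexedSum {a ℓ : Level} (M : CommutativeMonoid a ℓ) where
  open CommutativeMonoid M renaming (_∙_ to _+_; ε to 0#; identityˡ to +-identityˡ; ∙-congʳ to +-congʳ)
  open import Algebra.Properties.CommutativeMonoid.Sum M
    using (sum; sum-cong-≋; sum-cong-≗; sum-init-last; sum-replicate-zero)
  open import Relation.Binary.Reasoning.Setoid setoid

  ∑< : ℕ → (ℕ → Carrier) → Carrier
  ∑< n f = sum {n} (λ i → f (toℕ i))

  ∑<-cong : ∀ n {f g} → (∀ i → i < n → f i ≈ g i) → ∑< n f ≈ ∑< n g
  ∑<-cong n f≈g = sum-cong-≋ {n} (λ i → f≈g (toℕ i) (toℕ<n i))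

  ∑<-cong-≡ : ∀ n {f g} → (∀ i → f i ≡ g i) → ∑< n f ≡ ∑< n g
  ∑<-cong-≡ n f≡g = sum-cong-≗ {n} (λ i → f≡g (toℕ i))

  ∑<-suc : ∀ n f → ∑< (suc n) f ≈ ∑< n f + f n
  ∑<-suc n f = begin
    ∑< (suc n) f                                             ≈⟨ sum-init-last {n} (λ i → f (toℕ i)) ⟩
    sum {n} (λ i → f (toℕ (inject₁ i))) + f (toℕ (fromℕ n))  ≡⟨ cong₂ _+_ (sum-cong-≗ {n} (λ i → cong f (toℕ-inject₁ i)))
                                                                          (cong f (toℕ-fromℕ n)) ⟩
    ∑< n f + f n                                             ∎

  ∑<-zero : ∀ n {f} → (∀ i → f i ≈ 0#) → ∑< n f ≈ 0#
  ∑<-zero n f≈0 = trans (∑<-cong n (λ i _ → f≈0 i)) (sum-replicate-zero n)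

  ∑<-dropZeros : ∀ d n f → (∀ i → i < d → f i ≈ 0#) → ∑< n f ≈ ∑< (n ∸ d) (λ i → f (d ℕ.+ i))
  ∑<-dropZeros zero    n       f _   = refl
  ∑<-dropZeros (suc d) zero    f _   = refl
  ∑<-dropZeros (suc d) (suc n) f f≈0 = begin
    f 0 + ∑< n (λ i → f (suc i))  ≈⟨ +-congʳ (f≈0 0 (s≤s z≤n)) ⟩
    0# + ∑< n (λ i → f (suc i))   ≈⟨ +-identityˡ _ ⟩
    ∑< n (λ i → f (suc i))        ≈⟨ ∑<-dropZeros d n (λ i → f (suc i)) (λ i i<d → f≈0 (suc i) (s≤s i<d)) ⟩
    ∑< (n ∸ d) (λ i → f (suc (d ℕ.+ i))) ∎

open IndexedSum ℕ.+-0-commutativeMonoid using () renaming (∑< to ∑ℕ<; ∑<-cong-≡ to ∑ℕ<-cong)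

module BallotNumbers where
  open import Data.Nat using (_+_; _*_)
  open import Data.Nat.Properties
  open import Data.Nat.Combinatorics using (_C_; k>n⇒nCk≡0; nC1≡n; nCk≡nC[n∸k]; nCk+nC[k+1]≡[n+1]C[k+1])
  open import Data.Nat.DivMod using (_/_; m*n/n≡m)
  open import Data.Nat.Tactic.RingSolver using (solve-∀)
  open import Relation.Binary.PropositionalEquality

  -- ballot k d = C(k + d, k): Catalan's triangle indexed by the column and the gap d = n − k.
  ballot : ℕ → ℕ → ℕ
  ballot zero    d       = 1
  ballot (suc k) zero    = ballot k 1
  ballot (suc k) (suc d) = ballot (suc k) d + ballot k (suc (suc d))

  [k+1]*nC[k+1]+k*nCk≡n*nCk : ∀ n k → suc k * (n C suc k) + k * (n C k) ≡ n * (n C k)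
  [k+1]*nC[k+1]+k*nCk≡n*nCk zero    zero    = refl
  [k+1]*nC[k+1]+k*nCk≡n*nCk zero    (suc k) = cong₂ _+_ (*-zeroʳ (suc (suc k))) (*-zeroʳ (suc k))
  [k+1]*nC[k+1]+k*nCk≡n*nCk (suc n) zero    = begin
    1 * (suc n C 1) + 0  ≡⟨ trans (+-identityʳ _) (*-identityˡ _) ⟩
    suc n C 1            ≡⟨ nC1≡n (suc n) ⟩
    suc n                ≡⟨ *-identityʳ (suc n) ⟨
    suc n * 1            ∎
    where open ≡-Reasoning
  [k+1]*nC[k+1]+k*nCk≡n*nCk (suc n) (suc k) = begin
    suc (suc k) * (suc n C suc (suc k)) + suc k * (suc n C suc k)
      ≡⟨ cong₂ (λ u v → suc (suc k) * u + suc k * v) (nCk+nC[k+1]≡[n+1]C[k+1] n (suc k)) (nCk+nC[k+1]≡[n+1]C[k+1] n k) ⟨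
    suc (suc k) * (B + D) + suc k * (A + B)
      ≡⟨ regroup k A B D ⟩
    (suc (suc k) * D + suc k * B) + (suc k * B + k * A) + (A + B)
      ≡⟨ cong₂ (λ u v → u + v + (A + B)) ([k+1]*nC[k+1]+k*nCk≡n*nCk n (suc k)) ([k+1]*nC[k+1]+k*nCk≡n*nCk n k) ⟩
    n * B + n * A + (A + B)
      ≡⟨ collect n A B ⟩
    suc n * (A + B)
      ≡⟨ cong (suc n *_) (nCk+nC[k+1]≡[n+1]C[k+1] n k) ⟩
    suc n * (suc n C suc k) ∎
    where
    open ≡-Reasoning
    A B D : ℕ
    A = n C k
    B = n C suc k
    D = n C suc (suc k)
    regroup : ∀ k A B D → suc (suc k) * (B + D) + suc k * (A + B)
                        ≡ (suc (suc k) * D + suc k * B) + (suc k * B + k * A) + (A + B)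
    regroup = solve-∀
    collect : ∀ n A B → n * B + n * A + (A + B) ≡ suc n * (A + B)
    collect = solve-∀

  ballot-reflection : ∀ k d → ballot k d + (k + d + k) C suc (k + d) ≡ (k + d + k) C k
  ballot-reflection zero    d       = cong suc (k>n⇒nCk≡0 (s≤s (≤-reflexive (+-identityʳ d))))
  ballot-reflection (suc k) zero    = begin
    ballot k 1 + (suc k + 0 + suc k) C suc (suc k + 0)
      ≡⟨ cong₂ (λ m j → ballot k 1 + m C suc j) (total k) (column k) ⟩
    ballot k 1 + suc n C suc (k + 1)
      ≡⟨ cong (ballot k 1 +_) (nCk+nC[k+1]≡[n+1]C[k+1] n (k + 1)) ⟨
    ballot k 1 + (n C (k + 1) + n C suc (k + 1))
      ≡⟨ x+[y+z]≡[x+z]+y (ballot k 1) (n C (k + 1)) (n C suc (k + 1)) ⟩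
    (ballot k 1 + n C suc (k + 1)) + n C (k + 1)
      ≡⟨ cong₂ _+_ (ballot-reflection k 1) (cong (n C_) (+-comm k 1)) ⟩
    n C k + n C suc k
      ≡⟨ nCk+nC[k+1]≡[n+1]C[k+1] n k ⟩
    suc n C suc k
      ≡⟨ cong (_C suc k) (total k) ⟨
    (suc k + 0 + suc k) C suc k ∎
    where
    open ≡-Reasoning
    n : ℕ
    n = k + 1 + k
    total : ∀ k → suc k + 0 + suc k ≡ suc (k + 1 + k)
    total = solve-∀
    column : ∀ k → suc k + 0 ≡ k + 1
    column = solve-∀
    x+[y+z]≡[x+z]+y : ∀ x y z → x + (y + z) ≡ (x + z) + y
    x+[y+z]≡[x+z]+y = solve-∀
  ballot-reflection (suc k) (suc d) = begin
    (ballot (suc k) d + ballot k (suc (suc d))) + (suc k + suc d + suc k) C suc (suc k + suc d)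
      ≡⟨ cong₂ (λ m j → (ballot (suc k) d + ballot k (suc (suc d))) + m C suc j) (total₁ k d) (+-suc (suc k) d) ⟩
    (ballot (suc k) d + ballot k (suc (suc d))) + suc n C suc (suc (suc k + d))
      ≡⟨ cong (ballot (suc k) d + ballot k (suc (suc d)) +_) (nCk+nC[k+1]≡[n+1]C[k+1] n (suc (suc k + d))) ⟨
    (ballot (suc k) d + ballot k (suc (suc d))) + (n C suc (suc k + d) + n C suc (suc (suc k + d)))
      ≡⟨ interchange (ballot (suc k) d) (ballot k (suc (suc d))) (n C suc (suc k + d)) (n C suc (suc (suc k + d))) ⟩
    (ballot (suc k) d + n C suc (suc k + d)) + (ballot k (suc (suc d)) + n C suc (suc (suc k + d)))
      ≡⟨ cong₂ _+_ (ballot-reflection (suc k) d) reflection₂ ⟩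
    n C suc k + n C k
      ≡⟨ +-comm (n C suc k) (n C k) ⟩
    n C k + n C suc k
      ≡⟨ nCk+nC[k+1]≡[n+1]C[k+1] n k ⟩
    suc n C suc k
      ≡⟨ cong (_C suc k) (total₁ k d) ⟨
    (suc k + suc d + suc k) C suc k ∎
    where
    open ≡-Reasoning
    n : ℕ
    n = suc k + d + suc k
    total₁ : ∀ k d → suc k + suc d + suc k ≡ suc (suc k + d + suc k)
    total₁ = solve-∀
    total₂ : ∀ k d → k + suc (suc d) + k ≡ suc k + d + suc k
    total₂ = solve-∀
    column : ∀ k d → suc (suc k + d) ≡ k + suc (suc d)
    column = solve-∀
    interchange : ∀ a b c d → (a + b) + (c + d) ≡ (a + c) + (b + d)
    interchange = solve-∀
    reflection₂ : ballot k (suc (suc d)) + n C suc (suc (suc k + d)) ≡ n C k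
    reflection₂ = begin
      ballot k (suc (suc d)) + n C suc (suc (suc k + d))
        ≡⟨ cong₂ (λ m j → ballot k (suc (suc d)) + m C suc j) (sym (total₂ k d)) (column k d) ⟩
      ballot k (suc (suc d)) + (k + suc (suc d) + k) C suc (k + suc (suc d))
        ≡⟨ ballot-reflection k (suc (suc d)) ⟩
      (k + suc (suc d) + k) C k
        ≡⟨ cong (_C k) (total₂ k d) ⟩
      n C k ∎

  ballot-closedForm : ∀ k d → suc (k + d) * ballot k d ≡ suc d * ((k + d + k) C k)
  ballot-closedForm k d = +-cancelʳ-≡ (k * X) _ _ (begin
      suc n * ballot k d + k * X
        ≡⟨ cong (suc n * ballot k d +_) reflectedTerm ⟨
      suc n * ballot k d + suc n * (N C suc n)
        ≡⟨ *-distribˡ-+ (suc n) (ballot k d) (N C suc n) ⟨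
      suc n * (ballot k d + N C suc n)
        ≡⟨ cong (suc n *_) (ballot-reflection k d) ⟩
      suc n * X
        ≡⟨ split k d X ⟩
      suc d * X + k * X ∎)
    where
    open ≡-Reasoning
    n N X : ℕ
    n = k + d
    N = n + k
    X = N C k
    symmetric : N C n ≡ X
    symmetric = trans (nCk≡nC[n∸k] (m≤m+n n k)) (cong (N C_) (m+n∸m≡n n k))
    reflectedTerm : suc n * (N C suc n) ≡ k * X
    reflectedTerm = +-cancelʳ-≡ (n * X) _ _ (begin
      suc n * (N C suc n) + n * X  ≡⟨ cong (λ y → suc n * (N C suc n) + n * y) symmetric ⟨
      suc n * (N C suc n) + n * (N C n)  ≡⟨ [k+1]*nC[k+1]+k*nCk≡n*nCk N n ⟩
      N * (N C n)  ≡⟨ cong (N *_) symmetric ⟩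
      (n + k) * X  ≡⟨ *-distribʳ-+ X n k ⟩
      n * X + k * X  ≡⟨ +-comm (n * X) (k * X) ⟩
      k * X + n * X ∎)
    split : ∀ k d X → suc (k + d) * X ≡ suc d * X + k * X
    split = solve-∀

  catTri≡ballot : ∀ k d → catTri (k + d) k ≡ ballot k d
  catTri≡ballot k d = begin
    ((suc (k + d) ∸ k) * X) / suc (k + d)  ≡⟨ cong (λ m → (m * X) / suc (k + d)) rowMinusColumn ⟩
    (suc d * X) / suc (k + d)
      ≡⟨ cong (_/ suc (k + d)) (trans (*-comm (ballot k d) (suc (k + d))) (ballot-closedForm k d)) ⟨
    (ballot k d * suc (k + d)) / suc (k + d) ≡⟨ m*n/n≡m (ballot k d) (suc (k + d)) ⟩
    ballot k d ∎
    where
    open ≡-Reasoning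
    X : ℕ
    X = (k + d + k) C k
    rowMinusColumn : suc (k + d) ∸ k ≡ suc d
    rowMinusColumn = trans (cong (_∸ k) (sym (+-suc k d))) (m+n∸m≡n k (suc d))

  catalan≡ballot : ∀ k → catalan k ≡ ballot k 0
  catalan≡ballot k = begin
    ((2 * k) C k) / suc k          ≡⟨ cong (λ m → (m C k) / suc k) (double k) ⟩
    ((k + 0 + k) C k) / suc k      ≡⟨ cong (_/ suc k) closedForm ⟨
    (ballot k 0 * suc k) / suc k   ≡⟨ m*n/n≡m (ballot k 0) (suc k) ⟩
    ballot k 0 ∎
    where
    open ≡-Reasoning
    double : ∀ k → 2 * k ≡ k + 0 + k
    double = solve-∀
    closedForm : ballot k 0 * suc k ≡ (k + 0 + k) C k
    closedForm = begin
      ballot k 0 * suc k ≡⟨ *-comm (ballot k 0) (suc k) ⟩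
      suc k * ballot k 0 ≡⟨ cong (λ m → suc m * ballot k 0) (+-identityʳ k) ⟨
      suc (k + 0) * ballot k 0 ≡⟨ ballot-closedForm k 0 ⟩
      1 * ((k + 0 + k) C k) ≡⟨ *-identityˡ _ ⟩
      (k + 0 + k) C k ∎

  catTri-row≡ballot : ∀ {p i} → i ≤ p → catTri p (p ∸ i) ≡ ballot (p ∸ i) i
  catTri-row≡ballot {p} {i} i≤p = trans (cong (λ r → catTri r (p ∸ i)) (sym (m∸n+n≡m i≤p))) (catTri≡ballot (p ∸ i) i)

  ballot-suffixSum : ∀ p j → j ≤ p → ∑ℕ< (suc p ∸ j) (λ i → ballot (p ∸ (j + i)) (j + i)) ≡ ballot (p ∸ j) (suc j)
  ballot-suffixSum p j j≤p = begin
    ∑ℕ< (suc p ∸ j) (λ i → ballot (p ∸ (j + i)) (j + i))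
      ≡⟨ cong (λ m → ∑ℕ< m (λ i → ballot (p ∸ (j + i)) (j + i))) (+-∸-assoc 1 j≤p) ⟩
    ∑ℕ< (suc (p ∸ j)) (λ i → ballot (p ∸ (j + i)) (j + i))
      ≡⟨ ∑ℕ<-cong (suc (p ∸ j)) (λ i → cong (λ e → ballot e (j + i)) (sym (∸-+-assoc p j i))) ⟩
    ∑ℕ< (suc (p ∸ j)) (λ i → ballot (p ∸ j ∸ i) (j + i))
      ≡⟨ suffixSum (p ∸ j) j ⟩
    ballot (p ∸ j) (suc j) ∎
    where
    open ≡-Reasoning
    suffixSum : ∀ e j → ∑ℕ< (suc e) (λ i → ballot (e ∸ i) (j + i)) ≡ ballot e (suc j)
    suffixSum zero    j = refl
    suffixSum (suc e) j = begin
      ballot (suc e) (j + 0) + ∑ℕ< (suc e) (λ i → ballot (e ∸ i) (j + suc i))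
        ≡⟨ cong₂ _+_ (cong (ballot (suc e)) (+-identityʳ j)) (∑ℕ<-cong (suc e) (λ i → cong (ballot (e ∸ i)) (+-suc j i))) ⟩
      ballot (suc e) j + ∑ℕ< (suc e) (λ i → ballot (e ∸ i) (suc j + i))
        ≡⟨ cong (ballot (suc e) j +_) (suffixSum e (suc j)) ⟩
      ballot (suc e) (suc j) ∎

open BallotNumbers

m<n∸o⇒o+m<n : ∀ o {m n} → m < n ∸ o → o ℕ.+ m < n
m<n∸o⇒o+m<n zero    m<n∸o             = m<n∸o
m<n∸o⇒o+m<n (suc o) {n = suc n} m<n∸o = s≤s (m<n∸o⇒o+m<n o m<n∸o)

module _ {r ℓ : Level} (R : CommutativeRing r ℓ) where
  open CommutativeRing R
  open IndexedSum +-commutativeMonoid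
  open import Algebra.Properties.CommutativeMonoid.Mult +-commutativeMonoid
    using (_×_; ×-congʳ; ×-congˡ; ×-cong; ×-homo-1; ×-homo-+; ×-distrib-+)
  open import Algebra.Solver.CommutativeMonoid +-commutativeMonoid using (solve; _⊕_; _⊜_)
  open import Relation.Binary.Reasoning.Setoid setoid

  ·≡× : ∀ k a → _·_ R k a ≡ k × a
  ·≡× zero    a = ≡.refl
  ·≡× (suc k) a = cong (a +_) (·≡× k a)

  ×-zeroʳ : ∀ k → k × 0# ≈ 0#
  ×-zeroʳ zero    = refl
  ×-zeroʳ (suc k) = trans (+-identityˡ _) (×-zeroʳ k)

  ∑ℕ<-× : ∀ n (c : ℕ → ℕ) a → ∑ℕ< n c × a ≈ ∑< n (λ i → c i × a)
  ∑ℕ<-× zero    c a = refl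
  ∑ℕ<-× (suc n) c a = trans (×-homo-+ a (c 0) (∑ℕ< n (λ i → c (suc i)))) (+-congˡ (∑ℕ<-× n (λ i → c (suc i)) a))

  ∑<-×-prefixSums : ∀ m (c : ℕ → ℕ) a T →
    ∑< m (λ i → c i × (a + ∑< (suc i) T)) ≈ ∑ℕ< m c × a + ∑< m (λ j → ∑ℕ< (m ∸ j) (λ i → c (j ℕ.+ i)) × T j)
  ∑<-×-prefixSums zero    c a T = sym (+-identityˡ 0#)
  ∑<-×-prefixSums (suc m) c a T = begin
    c 0 × (a + (T 0 + 0#)) + ∑< m (λ i → c (suc i) × (a + (T 0 + ∑< (suc i) T′)))
      ≈⟨ +-cong (×-congʳ (c 0) (+-congˡ (+-identityʳ (T 0))))
                (∑<-cong m (λ i _ → ×-congʳ (c (suc i)) (sym (+-assoc a (T 0) (∑< (suc i) T′))))) ⟩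
    c 0 × a′ + ∑< m (λ i → c (suc i) × (a′ + ∑< (suc i) T′))
      ≈⟨ +-congˡ (∑<-×-prefixSums m c′ a′ T′) ⟩
    c 0 × a′ + (∑ℕ< m c′ × a′ + rest)
      ≈⟨ sym (+-assoc _ _ _) ⟩
    (c 0 × a′ + ∑ℕ< m c′ × a′) + rest
      ≈⟨ +-congʳ (sym (×-homo-+ a′ (c 0) (∑ℕ< m c′))) ⟩
    ∑ℕ< (suc m) c × (a + T 0) + rest
      ≈⟨ +-congʳ (×-distrib-+ a (T 0) (∑ℕ< (suc m) c)) ⟩
    (∑ℕ< (suc m) c × a + ∑ℕ< (suc m) c × T 0) + rest
      ≈⟨ +-assoc _ _ _ ⟩
    ∑ℕ< (suc m) c × a + (∑ℕ< (suc m) c × T 0 + rest) ∎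
    where
    c′ : ℕ → ℕ
    c′ i = c (suc i)
    T′ : ℕ → Carrier
    T′ i = T (suc i)
    a′ : Carrier
    a′ = a + T 0
    rest : Carrier
    rest = ∑< m (λ j → ∑ℕ< (m ∸ j) (λ i → c′ (j ℕ.+ i)) × T′ j)

  sumR-++ : ∀ xs ys → sumR R (xs ++ ys) ≈ sumR R xs + sumR R ys
  sumR-++ []       ys = sym (+-identityˡ _)
  sumR-++ (x ∷ xs) ys = trans (+-congˡ (sumR-++ xs ys)) (sym (+-assoc _ _ _))

  sumR-map-cong : ∀ {A : Set} {f g : A → Carrier} xs → (∀ a → f a ≈ g a) → sumR R (map f xs) ≈ sumR R (map g xs)
  sumR-map-cong []       f≈g = refl
  sumR-map-cong (x ∷ xs) f≈g = +-cong (f≈g x) (sumR-map-cong xs f≈g)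

  sumR-map-zero : ∀ {A : Set} {f : A → Carrier} xs → (∀ a → f a ≈ 0#) → sumR R (map f xs) ≈ 0#
  sumR-map-zero []       f≈0 = refl
  sumR-map-zero (x ∷ xs) f≈0 = trans (+-cong (f≈0 x) (sumR-map-zero xs f≈0)) (+-identityˡ 0#)

  sumR-map-concatMap : ∀ {A B : Set} (g : B → Carrier) (F : A → List B) xs →
    sumR R (map g (concatMap F xs)) ≈ sumR R (map (λ a → sumR R (map g (F a))) xs)
  sumR-map-concatMap g F []       = refl
  sumR-map-concatMap g F (x ∷ xs) = begin
    sumR R (map g (F x ++ concatMap F xs))             ≡⟨ cong (sumR R) (map-++ g (F x) (concatMap F xs)) ⟩
    sumR R (map g (F x) ++ map g (concatMap F xs))     ≈⟨ sumR-++ (map g (F x)) _ ⟩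
    sumR R (map g (F x)) + sumR R (map g (concatMap F xs)) ≈⟨ +-congˡ (sumR-map-concatMap g F xs) ⟩
    sumR R (map g (F x)) + sumR R (map (λ a → sumR R (map g (F a))) xs) ∎

  sumR-map-filter : ∀ {A : Set} (P : A → Bool) (g : A → Carrier) xs →
    sumR R (map g (filter (λ a → T? (P a)) xs)) ≈ sumR R (map (λ a → if P a then g a else 0#) xs)
  sumR-map-filter P g []       = refl
  sumR-map-filter P g (x ∷ xs) with P x
  ... | true  = +-congˡ (sumR-map-filter P g xs)
  ... | false = trans (sumR-map-filter P g xs) (sym (+-identityˡ _))

  sumR-map-applyUpTo : ∀ (g : ℕ → Carrier) u n → sumR R (map g (applyUpTo u n)) ≡ ∑< n (λ i → g (u i))
  sumR-map-applyUpTo g u zero    = ≡.refl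
  sumR-map-applyUpTo g u (suc n) = cong (g (u 0) +_) (sumR-map-applyUpTo g (λ i → u (suc i)) n)

  Σ[⋯]≡∑< : ∀ lo hi f → Σ[_⋯_] R lo hi f ≡ ∑< (suc hi ∸ lo) (λ i → f (lo ℕ.+ i))
  Σ[⋯]≡∑< lo hi f = ≡.trans (cong (sumR R) (≡.sym (map-∘ (upTo (suc hi ∸ lo)))))
                          (sumR-map-applyUpTo (λ i → f (lo ℕ.+ i)) (λ i → i) (suc hi ∸ lo))

  Σ[⋯]-suc : ∀ lo hi g → Σ[_⋯_] R (suc lo) (suc hi) g ≡ Σ[_⋯_] R lo hi (λ v → g (suc v))
  Σ[⋯]-suc lo hi g = ≡.trans (Σ[⋯]≡∑< (suc lo) (suc hi) g) (≡.sym (Σ[⋯]≡∑< lo hi (λ v → g (suc v))))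

  Σ[⋯]-cons : ∀ {lo hi} g → lo ≤ hi → Σ[_⋯_] R lo hi g ≈ g lo + Σ[_⋯_] R (suc lo) hi g
  Σ[⋯]-cons {lo} {hi} g lo≤hi = begin
    Σ[_⋯_] R lo hi g                                  ≡⟨ Σ[⋯]≡∑< lo hi g ⟩
    ∑< (suc hi ∸ lo) (λ i → g (lo ℕ.+ i))             ≡⟨ cong (λ n → ∑< n (λ i → g (lo ℕ.+ i))) (ℕ.+-∸-assoc 1 lo≤hi) ⟩
    g (lo ℕ.+ 0) + ∑< (hi ∸ lo) (λ i → g (lo ℕ.+ suc i))
      ≡⟨ cong₂ _+_ (cong g (ℕ.+-identityʳ lo)) (∑<-cong-≡ (hi ∸ lo) (λ i → cong g (ℕ.+-suc lo i))) ⟩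
    g lo + ∑< (hi ∸ lo) (λ i → g (suc lo ℕ.+ i))      ≡⟨ cong (g lo +_) (≡.sym (Σ[⋯]≡∑< (suc lo) hi g)) ⟩
    g lo + Σ[_⋯_] R (suc lo) hi g                     ∎

  Σ[⋯]-cong : ∀ lo hi {f g} → (∀ v → lo ≤ v → v ≤ hi → f v ≈ g v) → Σ[_⋯_] R lo hi f ≈ Σ[_⋯_] R lo hi g
  Σ[⋯]-cong lo hi {f} {g} f≈g = begin
    Σ[_⋯_] R lo hi f                       ≡⟨ Σ[⋯]≡∑< lo hi f ⟩
    ∑< (suc hi ∸ lo) (λ i → f (lo ℕ.+ i))
      ≈⟨ ∑<-cong (suc hi ∸ lo) (λ i i< → f≈g (lo ℕ.+ i) (ℕ.m≤m+n lo i) (ℕ.≤-pred (m<n∸o⇒o+m<n lo i<))) ⟩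
    ∑< (suc hi ∸ lo) (λ i → g (lo ℕ.+ i))  ≡⟨ Σ[⋯]≡∑< lo hi g ⟨
    Σ[_⋯_] R lo hi g                       ∎

  Σ[⋯]-restrict : ∀ {lo b} hi g → lo ≤ b →
    Σ[_⋯_] R lo hi (λ v → if b ≤ᵇ v then g v else 0#) ≈ Σ[_⋯_] R b hi g
  Σ[⋯]-restrict {lo} hi g lo≤b with (d , ≡.refl) ← ℕ.m≤n⇒∃[o]m+o≡n lo≤b = begin
    Σ[_⋯_] R lo hi (λ v → if lo ℕ.+ d ≤ᵇ v then g v else 0#)
      ≡⟨ Σ[⋯]≡∑< lo hi _ ⟩
    ∑< (suc hi ∸ lo) (λ i → if lo ℕ.+ d ≤ᵇ lo ℕ.+ i then g (lo ℕ.+ i) else 0#)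
      ≈⟨ ∑<-dropZeros d (suc hi ∸ lo) (λ i → if lo ℕ.+ d ≤ᵇ lo ℕ.+ i then g (lo ℕ.+ i) else 0#)
                      (λ i i<d → reflexive (if-false (ℕ.+-monoʳ-< lo i<d))) ⟩
    ∑< (suc hi ∸ lo ∸ d) (λ i → if lo ℕ.+ d ≤ᵇ lo ℕ.+ (d ℕ.+ i) then g (lo ℕ.+ (d ℕ.+ i)) else 0#)
      ≈⟨ ∑<-cong (suc hi ∸ lo ∸ d) (λ i _ → reflexive (≡.trans (if-true (ℕ.+-monoʳ-≤ lo (ℕ.m≤m+n d i)))
                                                              (cong g (≡.sym (ℕ.+-assoc lo d i))))) ⟩
    ∑< (suc hi ∸ lo ∸ d) (λ i → g (lo ℕ.+ d ℕ.+ i))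
      ≡⟨ cong (λ n → ∑< n (λ i → g (lo ℕ.+ d ℕ.+ i))) (ℕ.∸-+-assoc (suc hi) lo d) ⟩
    ∑< (suc hi ∸ (lo ℕ.+ d)) (λ i → g (lo ℕ.+ d ℕ.+ i))
      ≡⟨ Σ[⋯]≡∑< (lo ℕ.+ d) hi g ⟨
    Σ[_⋯_] R (lo ℕ.+ d) hi g ∎
    where
    if-true : ∀ {m n} {y z : Carrier} → m ≤ n → (if m ≤ᵇ n then y else z) ≡ y
    if-true {m} {n} m≤n = cong (λ t → if t then _ else _) (dec-true (m ℕ.≤? n) m≤n)
    if-false : ∀ {m n} {y z : Carrier} → n < m → (if m ≤ᵇ n then y else z) ≡ z
    if-false {m} {n} n<m = cong (λ t → if t then _ else _) (dec-false (m ℕ.≤? n) (ℕ.<⇒≱ n<m))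

  nestedSum : (ℕ → Carrier) → ℕ → ℕ → ℕ → Carrier
  nestedSum f M zero    v = f v
  nestedSum f M (suc h) v = Σ[_⋯_] R v M (nestedSum f M h)

  nestedSum-from1 : ∀ f M h → 1 ≤ M → nestedSum f M h 1 ≈ f 1 + ∑< h (λ j → nestedSum f M (suc j) 2)
  nestedSum-from1 f M zero    1≤M = sym (+-identityʳ (f 1))
  nestedSum-from1 f M (suc h) 1≤M = begin
    nestedSum f M (suc h) 1                         ≈⟨ Σ[⋯]-cons (nestedSum f M h) 1≤M ⟩
    nestedSum f M h 1 + S h                         ≈⟨ +-congʳ (nestedSum-from1 f M h 1≤M) ⟩
    (f 1 + ∑< h S) + S h                            ≈⟨ +-assoc (f 1) (∑< h S) (S h) ⟩
    f 1 + (∑< h S + S h)                            ≈⟨ +-congˡ (∑<-suc h S) ⟨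
    f 1 + ∑< (suc h) S                              ∎
    where
    S : ℕ → Carrier
    S j = nestedSum f M (suc j) 2

  -- chainSum f vs b h sums f over the last entries of b ∷ t, for the nondecreasing such lists with
  -- t an h-tuple from vs; ndSum is the case b = 0.
  chainTerm : (ℕ → Carrier) → ℕ → List ℕ → Carrier
  chainTerm f b t = if nondecreasing (b ∷ t) then f (lastEntry (b ∷ t)) else 0#

  chainSum : (ℕ → Carrier) → List ℕ → ℕ → ℕ → Carrier
  chainSum f vs b h = sumR R (map (chainTerm f b) (tuples h vs))

  chainSum-suc : ∀ f vs b h → chainSum f vs b (suc h) ≈ sumR R (map (λ v → if b ≤ᵇ v then chainSum f vs v h else 0#) vs)
  chainSum-suc f vs b h = begin
    sumR R (map (chainTerm f b) (concatMap (λ v → map (v ∷_) (tuples h vs)) vs))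
      ≈⟨ sumR-map-concatMap (chainTerm f b) (λ v → map (v ∷_) (tuples h vs)) vs ⟩
    sumR R (map (λ v → sumR R (map (chainTerm f b) (map (v ∷_) (tuples h vs)))) vs)
      ≈⟨ sumR-map-cong vs (λ v → trans (reflexive (cong (sumR R) (≡.sym (map-∘ (tuples h vs))))) (startingWith v)) ⟩
    sumR R (map (λ v → if b ≤ᵇ v then chainSum f vs v h else 0#) vs) ∎
    where
    startingWith : ∀ v → sumR R (map (λ t → if (b ≤ᵇ v) ∧ nondecreasing (v ∷ t) then f (lastEntry (v ∷ t)) else 0#)
                                     (tuples h vs))
                         ≈ (if b ≤ᵇ v then chainSum f vs v h else 0#)
    startingWith v with b ≤ᵇ v
    ... | true  = refl
    ... | false = sumR-map-zero (tuples h vs) (λ _ → refl)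

  chainSum≈nestedSum : ∀ f lo hi h {b} → lo ≤ b → chainSum f (range lo hi) b h ≈ nestedSum f hi h b
  chainSum≈nestedSum f lo hi zero    {b} lo≤b = +-identityʳ (f b)
  chainSum≈nestedSum f lo hi (suc h) {b} lo≤b = begin
    chainSum f (range lo hi) b (suc h)
      ≈⟨ chainSum-suc f (range lo hi) b h ⟩
    Σ[_⋯_] R lo hi (λ v → if b ≤ᵇ v then chainSum f (range lo hi) v h else 0#)
      ≈⟨ Σ[⋯]-restrict hi (λ v → chainSum f (range lo hi) v h) lo≤b ⟩
    Σ[_⋯_] R b hi (λ v → chainSum f (range lo hi) v h)
      ≈⟨ Σ[⋯]-cong b hi (λ v b≤v _ → chainSum≈nestedSum f lo hi h (ℕ.≤-trans lo≤b b≤v)) ⟩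
    nestedSum f hi (suc h) b ∎

  ndSum≈nestedSum : ∀ h lo hi f → ndSum R (suc h) lo hi f ≈ nestedSum f hi (suc h) lo
  ndSum≈nestedSum h lo hi f = begin
    ndSum R (suc h) lo hi f
      ≈⟨ sumR-map-filter nondecreasing (λ t → f (lastEntry t)) (tuples (suc h) (range lo hi)) ⟩
    sumR R (map (λ t → if nondecreasing t then f (lastEntry t) else 0#) (tuples (suc h) (range lo hi)))
      ≡⟨ cong (sumR R) (map-cong chainTerm-from0 (tuples (suc h) (range lo hi))) ⟩
    chainSum f (range lo hi) 0 (suc h)
      ≈⟨ chainSum-suc f (range lo hi) 0 h ⟩
    Σ[_⋯_] R lo hi (λ v → chainSum f (range lo hi) v h)
      ≈⟨ Σ[⋯]-cong lo hi (λ v lo≤v _ → chainSum≈nestedSum f lo hi h lo≤v) ⟩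
    nestedSum f hi (suc h) lo ∎
    where
    chainTerm-from0 : ∀ t → (if nondecreasing t then f (lastEntry t) else 0#) ≡ chainTerm f 0 t
    chainTerm-from0 []      = ≡.refl
    chainTerm-from0 (_ ∷ _) = ≡.refl

  module _ (x : ℕ → ℕ → Carrier)
           (hyp : ∀ n k → 1 ≤ n → 1 ≤ k → k ≤ n → x (suc n) (suc k) ≈ Σ[_⋯_] R k n (x n)) where

    nested : ℕ → ℕ → ℕ → Carrier
    nested M = nestedSum (x M) M

    nested-shift : ∀ M h {u} → 1 ≤ u → u ≤ M → nested (suc M) h (suc u) ≈ nested M (suc h) u
    nested-shift M zero    {u} 1≤u u≤M = hyp M u (ℕ.≤-trans 1≤u u≤M) 1≤u u≤M
    nested-shift M (suc h) {u} 1≤u u≤M = begin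
      Σ[_⋯_] R (suc u) (suc M) (nested (suc M) h)      ≡⟨ Σ[⋯]-suc u M (nested (suc M) h) ⟩
      Σ[_⋯_] R u M (λ w → nested (suc M) h (suc w))
        ≈⟨ Σ[⋯]-cong u M (λ w u≤w w≤M → nested-shift M h (ℕ.≤-trans 1≤u u≤w) w≤M) ⟩
      nested M (suc (suc h)) u ∎

    nested-lower : ∀ N h → 1 ≤ N → nested (suc N) h 2 ≈ x N 1 + ∑< (suc h) (λ j → nested N (suc j) 2)
    nested-lower N h 1≤N = trans (nested-shift N h ℕ.≤-refl 1≤N) (nestedSum-from1 (x N) N (suc h) 1≤N)

    catalanSum : ℕ → ℕ → Carrier
    catalanSum n m = ∑< m (λ k → _·_ R (catalan k) (x (n ∸ k ∸ 1) 1))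

    expansion : ∀ p N n → n ≡ suc p ℕ.+ N → 1 ≤ N →
      x n 2 ≈ ∑< (suc p) (λ i → ballot (p ∸ i) i × nested N (suc i) 2) + catalanSum n (suc p)
    expansion zero N n ≡.refl 1≤N = begin
      x (suc N) 2                       ≈⟨ nested-lower N 0 1≤N ⟩
      x N 1 + ∑< 1 S                    ≈⟨ +-comm (x N 1) (∑< 1 S) ⟩
      ∑< 1 S + x N 1                    ≈⟨ +-cong (∑<-cong 1 (λ i _ → ×-homo-1 (S i))) (trans (+-identityʳ _) (+-identityʳ (x N 1))) ⟨
      ∑< 1 (λ i → 1 × S i) + catalanSum (suc N) 1 ∎
      where
      S : ℕ → Carrier
      S j = nested N (suc j) 2
    expansion (suc p) N n ≡.refl 1≤N = begin
      x n 2
        ≈⟨ expansion p (suc N) n (≡.sym (ℕ.+-suc (suc p) N)) (s≤s z≤n) ⟩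
      ∑< (suc p) (λ i → c i × nested (suc N) (suc i) 2) + catalanSum n (suc p)
        ≈⟨ +-congʳ (∑<-cong (suc p) (λ i _ → ×-congʳ (c i) (lowered i))) ⟩
      ∑< (suc p) (λ i → c i × (a + ∑< (suc i) T)) + catalanSum n (suc p)
        ≈⟨ +-congʳ (∑<-×-prefixSums (suc p) c a T) ⟩
      (∑ℕ< (suc p) c × a + ∑< (suc p) (λ j → ∑ℕ< (suc p ∸ j) (λ i → c (j ℕ.+ i)) × T j)) + catalanSum n (suc p)
        ≈⟨ +-congʳ (+-cong (×-congˡ {a} (suffix 0 (s≤s z≤n))) (∑<-cong (suc p) (λ j j<1+p → ×-congˡ {T j} (suffix j j<1+p)))) ⟩
      (K × (x N 1 + S 0) + higher) + catalanSum n (suc p)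
        ≈⟨ +-congʳ (+-congʳ (×-distrib-+ (x N 1) (S 0) K)) ⟩
      ((K × x N 1 + K × S 0) + higher) + catalanSum n (suc p)
        ≈⟨ solve 4 (λ A B Y Z → ((A ⊕ B) ⊕ Y) ⊕ Z ⊜ (B ⊕ Y) ⊕ (Z ⊕ A)) refl (K × x N 1) (K × S 0) higher (catalanSum n (suc p)) ⟩
      ∑< (suc (suc p)) (λ i → c′ i × S i) + (catalanSum n (suc p) + K × x N 1)
        ≈⟨ +-congˡ (+-congˡ newCatalanTerm) ⟩
      ∑< (suc (suc p)) (λ i → c′ i × S i) + (catalanSum n (suc p) + _·_ R (catalan (suc p)) (x (n ∸ suc p ∸ 1) 1))
        ≈⟨ +-congˡ (∑<-suc (suc p) (λ k → _·_ R (catalan k) (x (n ∸ k ∸ 1) 1))) ⟨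
      ∑< (suc (suc p)) (λ i → c′ i × S i) + catalanSum n (suc (suc p)) ∎
      where
      c c′ : ℕ → ℕ
      c i = ballot (p ∸ i) i
      c′ i = ballot (suc p ∸ i) i
      K : ℕ
      K = ballot (suc p) 0
      S T : ℕ → Carrier
      S j = nested N (suc j) 2
      T j = S (suc j)
      a higher : Carrier
      a = x N 1 + S 0
      higher = ∑< (suc p) (λ j → c′ (suc j) × S (suc j))
      suffix : ∀ j → j < suc p → ∑ℕ< (suc p ∸ j) (λ i → c (j ℕ.+ i)) ≡ c′ (suc j)
      suffix j j<1+p = ballot-suffixSum p j (ℕ.≤-pred j<1+p)
      lowered : ∀ i → nested (suc N) (suc i) 2 ≈ a + ∑< (suc i) T
      lowered i = trans (nested-lower N (suc i) 1≤N) (sym (+-assoc (x N 1) (S 0) (∑< (suc i) T)))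
      n∸[p+2]≡N : n ∸ suc p ∸ 1 ≡ N
      n∸[p+2]≡N = ≡.trans (cong (λ m → m ∸ p ∸ 1) (≡.sym (ℕ.+-suc p N))) (cong (_∸ 1) (ℕ.m+n∸m≡n p (suc N)))
      newCatalanTerm : K × x N 1 ≈ _·_ R (catalan (suc p)) (x (n ∸ suc p ∸ 1) 1)
      newCatalanTerm = begin
        K × x N 1                                      ≈⟨ ×-cong (≡.sym (catalan≡ballot (suc p)))
                                                                 (reflexive (cong (λ m → x m 1) (≡.sym n∸[p+2]≡N))) ⟩
        catalan (suc p) × x (n ∸ suc p ∸ 1) 1          ≡⟨ ·≡× (catalan (suc p)) (x (n ∸ suc p ∸ 1) 1) ⟨
        _·_ R (catalan (suc p)) (x (n ∸ suc p ∸ 1) 1)  ∎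

    x₂-expansion : ∀ n m → 3 ≤ n → 1 ≤ m → m ≤ n ∸ 2 →
      x n 2 ≈ (Σ[_⋯_] R 1 m (λ h → _·_ R (catTri (m ∸ 1) (m ∸ h)) (ndSum R h 2 (n ∸ m) (x (n ∸ m))))
               + Σ[_⋯_] R 0 (m ∸ 1) (λ k → _·_ R (catalan k) (x (n ∸ k ∸ 1) 1)))
    x₂-expansion n@(suc (suc n′)) (suc p) (s≤s (s≤s _)) _ m≤n∸2 = begin
      x n 2
        ≈⟨ expansion p N n (≡.sym (ℕ.m+[n∸m]≡n m≤n)) (ℕ.m<n⇒0<n∸m (ℕ.≤-trans m≤n∸2 (ℕ.n≤1+n n′))) ⟩
      ∑< (suc p) (λ i → ballot (p ∸ i) i × nested N (suc i) 2) + catalanSum n (suc p)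
        ≈⟨ +-congʳ (∑<-cong (suc p) (λ i i<1+p → sym (coefficient i (ℕ.≤-pred i<1+p)))) ⟩
      ∑< (suc p) (λ i → _·_ R (catTri p (p ∸ i)) (ndSum R (suc i) 2 N (x N))) + catalanSum n (suc p)
        ≡⟨ cong₂ _+_ (Σ[⋯]≡∑< 1 (suc p) term) (Σ[⋯]≡∑< 0 p catalanTerm) ⟨
      Σ[_⋯_] R 1 (suc p) (λ h → _·_ R (catTri p (suc p ∸ h)) (ndSum R h 2 N (x N)))
               + Σ[_⋯_] R 0 p (λ k → _·_ R (catalan k) (x (n ∸ k ∸ 1) 1)) ∎
      where
      N : ℕ
      N = n ∸ suc p
      term : ℕ → Carrier
      term h = _·_ R (catTri p (suc p ∸ h)) (ndSum R h 2 N (x N))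
      catalanTerm : ℕ → Carrier
      catalanTerm k = _·_ R (catalan k) (x (n ∸ k ∸ 1) 1)
      m≤n : suc p ≤ n
      m≤n = ℕ.≤-trans m≤n∸2 (ℕ.≤-trans (ℕ.n≤1+n n′) (ℕ.n≤1+n (suc n′)))
      coefficient : ∀ i → i ≤ p →
        _·_ R (catTri p (p ∸ i)) (ndSum R (suc i) 2 N (x N)) ≈ ballot (p ∸ i) i × nested N (suc i) 2
      coefficient i i≤p = begin
        _·_ R (catTri p (p ∸ i)) (ndSum R (suc i) 2 N (x N)) ≡⟨ ·≡× (catTri p (p ∸ i)) (ndSum R (suc i) 2 N (x N)) ⟩
        catTri p (p ∸ i) × ndSum R (suc i) 2 N (x N)         ≈⟨ ×-cong (catTri-row≡ballot i≤p) (ndSum≈nestedSum i 2 N (x N)) ⟩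
        ballot (p ∸ i) i × nested N (suc i) 2                ∎

    x₂-catalanConvolution : ∀ n → 3 ≤ n → x n 2 ≈ Σ[_⋯_] R 0 (n ∸ 2) (λ k → _·_ R (catalan k) (x (n ∸ k ∸ 1) 1))
    x₂-catalanConvolution n@(suc (suc p)) (s≤s (s≤s _)) = begin
      x n 2
        ≈⟨ expansion p 1 n (cong suc (ℕ.+-comm 1 p)) ℕ.≤-refl ⟩
      ∑< (suc p) (λ i → ballot (p ∸ i) i × nested 1 (suc i) 2) + catalanSum n (suc p)
        ≈⟨ +-congʳ (∑<-zero (suc p) (λ i → ×-zeroʳ (ballot (p ∸ i) i))) ⟩
      0# + catalanSum n (suc p)
        ≈⟨ +-identityˡ _ ⟩
      catalanSum n (suc p)
        ≡⟨ Σ[⋯]≡∑< 0 p (λ k → _·_ R (catalan k) (x (n ∸ k ∸ 1) 1)) ⟨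
      Σ[_⋯_] R 0 p (λ k → _·_ R (catalan k) (x (n ∸ k ∸ 1) 1)) ∎

open import Data.Product using (_×_)

proposition3p5 : {c ℓ : Level} (R : CommutativeRing c ℓ) →
    let open CommutativeRing R in
    (x : ℕ → ℕ → Carrier) →
    (∀ n k → 1 ≤ n → 1 ≤ k → k ≤ n → x (suc n) (suc k) ≈ Σ[_⋯_] R k n (x n)) →
    (∀ n m → 3 ≤ n → 1 ≤ m → m ≤ n ∸ 2 →
      x n 2 ≈ (Σ[_⋯_] R 1 m (λ h → _·_ R (catTri (m ∸ 1) (m ∸ h)) (ndSum R h 2 (n ∸ m) (x (n ∸ m))))
               + Σ[_⋯_] R 0 (m ∸ 1) (λ k → _·_ R (catalan k) (x (n ∸ k ∸ 1) 1))))
    × (∀ n → 3 ≤ n → x n 2 ≈ Σ[_⋯_] R 0 (n ∸ 2) (λ k → _·_ R (catalan k) (x (n ∸ k ∸ 1) 1)))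
proposition3p5 R x hyp = x₂-expansion R x hyp , x₂-catalanConvolution R x hyp
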